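{- Let $\mathcal K\cup\{\mathbf A_u\}$ be a class of totally ordered strongly positively pointed Abelian $\ell$-groups. Then $\mathbf A_u\in\mathbf{ISP_U}(\mathcal K)$ if and only if $\Gamma(\mathbf A_u)\in\mathbf{ISP_U}(\Gamma[\mathcal K])$.
   Context: A pointed Abelian $\ell$-group $\mathbf A_u$ is an Abelian $\ell$-group $\mathbf A$ with a constant $\mathtt f$ interpreted as $u$; it is strongly positively pointed if $u\ge 0$ and $u$ is a strong unit (for every $c\in A$ there is $z\in\mathbb Z$ with $z\cdot u\ge c$). For such $\mathbf A_u$, $\Gamma(\mathbf A_u)$ is the MV-algebra $\langle[0,u],\oplus,\otimes,\vee,\wedge,\neg,0,u\rangle$ with $a\oplus b=(a+b)\wedge u$, $a\otimes b=0\vee(a+b-u)$, $\neg a=u-a$, and lattice operations inherited from $\mathbf A$; $\Gamma[\mathcal K]=\{\Gamma(\mathbf B_v)\mid\mathbf B_v\in\mathcal K\}$. $\mathbf{ISP_U}(\mathcal C)$ is the class of algebras isomorphic to subalgebras of ultrapowers of members of $\mathcal C$ (in the respective signature). -}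

module Defs where

open import Level using (Level; _⊔_; Lift; lift) renaming (suc to lsuc)
open import Data.Product using (Σ; ∃; _×_; _,_; proj₁; proj₂)
open import Data.Sum using (_⊎_)
open import Data.Unit using (⊤)
open import Data.Empty using (⊥)
open import Data.Nat using (ℕ; zero; suc)
open import Data.Integer using (ℤ; +_; -[1+_])
import Relation.Nullary as N
open import Relation.Unary using (Pred)
open import Relation.Binary.Core using (Rel)
open import Relation.Binary.Structures using (IsEquivalence)
open import Relation.Binary.PropositionalEquality using (_≡_)
open import Algebra.Core using (Op₁; Op₂)
open import Algebra.Structures using (IsAbelianGroup)
open import Algebra.Lattice.Structures using (IsLattice)

record LGroup (c ℓ : Level) : Set (lsuc (c ⊔ ℓ)) where
  infixl 6 _+_
  infixr 7 _∧_
  infixr 6 _∨_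
  infix 4 _≈_
  field
    Carrier : Set c
    _≈_ : Rel Carrier ℓ
    _+_ : Op₂ Carrier
    0# : Carrier
    -_ : Op₁ Carrier
    _∨_ : Op₂ Carrier
    _∧_ : Op₂ Carrier
    isAbelianGroup : IsAbelianGroup _≈_ _+_ 0# -_
    isLattice : IsLattice _≈_ _∨_ _∧_
    +-distribʳ-∨ : ∀ a b d → (a ∨ b) + d ≈ (a + d) ∨ (b + d)
    +-distribʳ-∧ : ∀ a b d → (a ∧ b) + d ≈ (a + d) ∧ (b + d)

  open IsAbelianGroup isAbelianGroup public
    using (isEquivalence; refl; sym; trans; ∙-cong; assoc; comm; identityʳ; identityˡ; inverseʳ; inverseˡ; ⁻¹-cong)
  open IsLattice isLattice public
    using (∨-comm; ∨-assoc; ∨-cong; ∧-comm; ∧-assoc; ∧-cong; ∨-absorbs-∧; ∧-absorbs-∨)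

  infix 4 _≤_
  _≤_ : Rel Carrier ℓ
  a ≤ b = a ∧ b ≈ a

  infixr 8 _·ℕ_ _·_
  _·ℕ_ : ℕ → Carrier → Carrier
  zero ·ℕ a = 0#
  suc n ·ℕ a = a + n ·ℕ a

  _·_ : ℤ → Carrier → Carrier
  (+ n) · a = n ·ℕ a
  -[1+ n ] · a = - (suc n ·ℕ a)

record PointedLGroup (c ℓ : Level) : Set (lsuc (c ⊔ ℓ)) where
  field
    lgroup : LGroup c ℓ
  open LGroup lgroup public
  field
    u : Carrier

module _ {c ℓ : Level} (A : PointedLGroup c ℓ) where
  open PointedLGroup A

  TotallyOrdered : Set (c ⊔ ℓ)
  TotallyOrdered = ∀ a b → a ≤ b ⊎ b ≤ a

  StrongUnit : Set (c ⊔ ℓ)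
  StrongUnit = ∀ d → ∃ λ (z : ℤ) → d ≤ z · u

  StronglyPositivelyPointed : Set (c ⊔ ℓ)
  StronglyPositivelyPointed = (0# ≤ u) × StrongUnit

module LGroupOrder {c ℓ : Level} (G : LGroup c ℓ) where
  open LGroup G

  ∧-idem : ∀ x → x ∧ x ≈ x
  ∧-idem x = trans (∧-cong refl (sym (∨-absorbs-∧ x x))) (∧-absorbs-∨ x (x ∧ x))

  ≤-refl : ∀ {x} → x ≤ x
  ≤-refl {x} = ∧-idem x

  ≤-trans : ∀ {x y z} → x ≤ y → y ≤ z → x ≤ z
  ≤-trans {x} {y} {z} p q =
    trans (∧-cong (sym p) refl) (trans (∧-assoc x y z) (trans (∧-cong refl q) p))

  ≤-respˡ : ∀ {x x' y} → x ≈ x' → x ≤ y → x' ≤ y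
  ≤-respˡ e p = trans (∧-cong (sym e) refl) (trans p e)

  ≤-respʳ : ∀ {x y y'} → y ≈ y' → x ≤ y → x ≤ y'
  ≤-respʳ e p = trans (∧-cong refl (sym e)) p

  x∧y≤y : ∀ x y → x ∧ y ≤ y
  x∧y≤y x y = trans (∧-assoc x y y) (∧-cong refl (∧-idem y))

  x∧y≤x : ∀ x y → x ∧ y ≤ x
  x∧y≤x x y = ≤-respˡ (∧-comm y x) (x∧y≤y y x)

  ∧-greatest : ∀ {x y z} → z ≤ x → z ≤ y → z ≤ x ∧ y
  ∧-greatest {x} {y} {z} p q =
    trans (sym (∧-assoc z x y)) (trans (∧-cong p refl) q)

  x≤x∨y : ∀ x y → x ≤ x ∨ y
  x≤x∨y x y = ∧-absorbs-∨ x y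

  y≤x∨y : ∀ x y → y ≤ x ∨ y
  y≤x∨y x y = ≤-respʳ (∨-comm y x) (x≤x∨y y x)

  ≤⇒∨ : ∀ {x z} → x ≤ z → x ∨ z ≈ z
  ≤⇒∨ {x} {z} p =
    trans (∨-cong (sym p) refl)
      (trans (∨-comm (x ∧ z) z) (trans (∨-cong refl (∧-comm x z)) (∨-absorbs-∧ z x)))

  ∨⇒≤ : ∀ {x z} → x ∨ z ≈ z → x ≤ z
  ∨⇒≤ {x} {z} p = trans (∧-cong refl (sym p)) (∧-absorbs-∨ x z)

  ∨-least : ∀ {x y z} → x ≤ z → y ≤ z → x ∨ y ≤ z
  ∨-least {x} {y} {z} p q =
    ∨⇒≤ (trans (∨-assoc x y z) (trans (∨-cong refl (≤⇒∨ q)) (≤⇒∨ p)))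

  +-monoʳ : ∀ {a b} d → a ≤ b → a + d ≤ b + d
  +-monoʳ {a} {b} d p = trans (sym (+-distribʳ-∧ a b d)) (∙-cong p refl)

  +-monoˡ : ∀ {a b} d → a ≤ b → d + a ≤ d + b
  +-monoˡ {a} {b} d p = ≤-respˡ (comm a d) (≤-respʳ (comm b d) (+-monoʳ d p))

  0≤+ : ∀ {a b} → 0# ≤ a → 0# ≤ b → 0# ≤ a + b
  0≤+ {a} {b} p q = ≤-trans p (≤-respˡ (identityʳ a) (+-monoˡ a q))

  ≤0-neg : ∀ {a} → 0# ≤ a → - a ≤ 0#
  ≤0-neg {a} p = ≤-respˡ (identityˡ (- a)) (≤-respʳ (inverseʳ a) (+-monoʳ (- a) p))

  0≤-sub : ∀ {a b} → a ≤ b → 0# ≤ b + - a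
  0≤-sub {a} {b} p = ≤-respˡ (inverseʳ a) (+-monoʳ (- a) p)

  sub≤ : ∀ {a b} → 0# ≤ a → b + - a ≤ b
  sub≤ {a} {b} p = ≤-respʳ (identityʳ b) (+-monoˡ b (≤0-neg p))

record MVStr (c ℓ : Level) : Set (lsuc (c ⊔ ℓ)) where
  infix 4 _≈_
  field
    Carrier : Set c
    _≈_ : Rel Carrier ℓ
    _⊕_ : Op₂ Carrier
    _⊗_ : Op₂ Carrier
    _∨_ : Op₂ Carrier
    _∧_ : Op₂ Carrier
    ¬_ : Op₁ Carrier
    0# : Carrier
    1# : Carrier
    isEquivalence : IsEquivalence _≈_
    ⊕-cong : ∀ {x x' y y'} → x ≈ x' → y ≈ y' → x ⊕ y ≈ x' ⊕ y'
    ⊗-cong : ∀ {x x' y y'} → x ≈ x' → y ≈ y' → x ⊗ y ≈ x' ⊗ y'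
    ∨-cong : ∀ {x x' y y'} → x ≈ x' → y ≈ y' → x ∨ y ≈ x' ∨ y'
    ∧-cong : ∀ {x x' y y'} → x ≈ x' → y ≈ y' → x ∧ y ≈ x' ∧ y'
    ¬-cong : ∀ {x x'} → x ≈ x' → ¬ x ≈ ¬ x'

Γ : {c ℓ : Level} (A : PointedLGroup c ℓ) → PointedLGroup._≤_ A (PointedLGroup.0# A) (PointedLGroup.u A) → MVStr (c ⊔ ℓ) ℓ
Γ {c} {ℓ} A 0≤u = record
  { Carrier = I
  ; _≈_ = λ x y → proj₁ x ≈ proj₁ y
  ; _⊕_ = _⊕_
  ; _⊗_ = _⊗_
  ; _∨_ = λ x y → (proj₁ x ∨ proj₁ y) , ∨-in x y
  ; _∧_ = λ x y → (proj₁ x ∧ proj₁ y) , ∧-in x y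
  ; ¬_ = λ x → (u + - proj₁ x) , 0≤-sub (proj₂ (proj₂ x)) , sub≤ (proj₁ (proj₂ x))
  ; 0# = 0# , ≤-refl , 0≤u
  ; 1# = u , 0≤u , ≤-refl
  ; isEquivalence = record { refl = refl ; sym = sym ; trans = trans }
  ; ⊕-cong = λ p q → ∧-cong (∙-cong p q) refl
  ; ⊗-cong = λ p q → ∨-cong refl (∙-cong (∙-cong p q) refl)
  ; ∨-cong = ∨-cong
  ; ∧-cong = ∧-cong
  ; ¬-cong = λ p → ∙-cong refl (⁻¹-cong p)
  }
  where
  open PointedLGroup A
  open LGroupOrder lgroup
  I : Set (c ⊔ ℓ)
  I = Σ Carrier (λ a → (0# ≤ a) × (a ≤ u))
  _⊕_ : I → I → I
  x ⊕ y = ((proj₁ x + proj₁ y) ∧ u)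
        , ∧-greatest (0≤+ (proj₁ (proj₂ x)) (proj₁ (proj₂ y))) 0≤u
        , x∧y≤y _ _
  _⊗_ : I → I → I
  x ⊗ y = (0# ∨ ((proj₁ x + proj₁ y) + - u))
        , x≤x∨y _ _
        , ∨-least 0≤u
            (≤-trans (≤-respˡ (sym (assoc (proj₁ x) (proj₁ y) (- u)))
                       (≤-respʳ (identityʳ (proj₁ x))
                         (+-monoˡ (proj₁ x)
                           (≤-respʳ (inverseʳ u) (+-monoʳ (- u) (proj₂ (proj₂ y)))))))
                     (proj₂ (proj₂ x)))
  ∨-in : ∀ x y → (0# ≤ proj₁ x ∨ proj₁ y) × (proj₁ x ∨ proj₁ y ≤ u)
  ∨-in x y = ≤-trans (proj₁ (proj₂ x)) (x≤x∨y _ _) , ∨-least (proj₂ (proj₂ x)) (proj₂ (proj₂ y))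
  ∧-in : ∀ x y → (0# ≤ proj₁ x ∧ proj₁ y) × (proj₁ x ∧ proj₁ y ≤ u)
  ∧-in x y = ∧-greatest (proj₁ (proj₂ x)) (proj₁ (proj₂ y)) , ≤-trans (x∧y≤x _ _) (proj₂ (proj₂ x))

record Ultrafilter {i : Level} (I : Set i) (p : Level) : Set (i ⊔ lsuc p) where
  field
    _∈U : Pred I p → Set p
    whole : (λ _ → Lift p ⊤) ∈U
    proper : N.¬ ((λ _ → Lift p ⊥) ∈U)
    upward : ∀ {X Y : Pred I p} → (∀ j → X j → Y j) → X ∈U → Y ∈U
    meet : ∀ {X Y : Pred I p} → X ∈U → Y ∈U → (λ j → X j × Y j) ∈U
    ultra : ∀ (X : Pred I p) → X ∈U ⊎ (λ j → N.¬ X j) ∈U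

-- An element of B^I/U is represented
-- by a function I → B, two being equal iff they agree on a U-large set;
-- all operations are computed pointwise.  A map h : A → B^I/U is thus
-- given by h : A → (I → B), and the conditions below say exactly that h
-- is a well-defined, injective homomorphism into the ultrapower.

record LEmbedding {c ℓ i : Level} (A B : PointedLGroup c ℓ) {I : Set i}
                  (U : Ultrafilter I ℓ) : Set (c ⊔ ℓ ⊔ i) where
  private
    module A = PointedLGroup A
    module B = PointedLGroup B
  open Ultrafilter U
  field
    h : A.Carrier → I → B.Carrier
    h-cong : ∀ {x y} → x A.≈ y → (λ j → h x j B.≈ h y j) ∈U
    h-inj : ∀ {x y} → (λ j → h x j B.≈ h y j) ∈U → x A.≈ y
    h-+ : ∀ x y → (λ j → h (x A.+ y) j B.≈ h x j B.+ h y j) ∈U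
    h-0 : (λ j → h A.0# j B.≈ B.0#) ∈U
    h-neg : ∀ x → (λ j → h (A.- x) j B.≈ B.- h x j) ∈U
    h-∨ : ∀ x y → (λ j → h (x A.∨ y) j B.≈ h x j B.∨ h y j) ∈U
    h-∧ : ∀ x y → (λ j → h (x A.∧ y) j B.≈ h x j B.∧ h y j) ∈U
    h-u : (λ j → h A.u j B.≈ B.u) ∈U

record MVEmbedding {c ℓ i : Level} (A B : MVStr c ℓ) {I : Set i}
                   (U : Ultrafilter I ℓ) : Set (c ⊔ ℓ ⊔ i) where
  private
    module A = MVStr A
    module B = MVStr B
  open Ultrafilter U
  field
    h : A.Carrier → I → B.Carrier
    h-cong : ∀ {x y} → x A.≈ y → (λ j → h x j B.≈ h y j) ∈U
    h-inj : ∀ {x y} → (λ j → h x j B.≈ h y j) ∈U → x A.≈ y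
    h-⊕ : ∀ x y → (λ j → h (x A.⊕ y) j B.≈ h x j B.⊕ h y j) ∈U
    h-⊗ : ∀ x y → (λ j → h (x A.⊗ y) j B.≈ h x j B.⊗ h y j) ∈U
    h-∨ : ∀ x y → (λ j → h (x A.∨ y) j B.≈ h x j B.∨ h y j) ∈U
    h-∧ : ∀ x y → (λ j → h (x A.∧ y) j B.≈ h x j B.∧ h y j) ∈U
    h-¬ : ∀ x → (λ j → h (A.¬ x) j B.≈ B.¬ h x j) ∈U
    h-0 : (λ j → h A.0# j B.≈ B.0#) ∈U
    h-1 : (λ j → h A.1# j B.≈ B.1#) ∈U

ISPU-ℓ : {c ℓ k : Level} (i : Level) → Pred (PointedLGroup c ℓ) k → Pred (PointedLGroup c ℓ) (lsuc (c ⊔ ℓ ⊔ i) ⊔ k)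
ISPU-ℓ i K A = Σ _ λ B → K B × Σ (Set i) λ I → Σ (Ultrafilter I _) λ U → LEmbedding A B U

ISPU-MV : {c ℓ k : Level} (i : Level) → Pred (MVStr c ℓ) k → Pred (MVStr c ℓ) (lsuc (c ⊔ ℓ ⊔ i) ⊔ k)
ISPU-MV i K M = Σ _ λ N → K N × Σ (Set i) λ I → Σ (Ultrafilter I _) λ U → MVEmbedding M N U

Γ[_] : {c ℓ k : Level} → Pred (PointedLGroup c ℓ) k → Pred (MVStr (c ⊔ ℓ) ℓ) (lsuc (c ⊔ ℓ) ⊔ k)
Γ[ K ] M = Σ _ λ B → K B × Σ (PointedLGroup._≤_ B (PointedLGroup.0# B) (PointedLGroup.u B)) λ p → M ≡ Γ B p

{-# OPTIONS --safe #-}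
-- An embedding of A_u into an ultrapower of B_v restricts to [0, u]; clipping every
-- coordinate into [0, v], which changes it only on a U-small set, turns the restriction
-- into an MV-embedding of Γ(A_u) into the ultrapower of Γ(B_v).
-- Conversely, view an MV-embedding g of Γ(A_u) as a map into the ultrapower C of B.
-- As A is a chain and u a strong unit, every a ∈ A is (p·u + r) − q·u with p, q ∈ ℕ and
-- r ∈ [0, u]; send it to (p·v + g r) − q·v.  Representations of one element differ only
-- by carries u = 1·u + 0, which g respects, and the sum of p·u + r and q·u + s is
-- (p+q)·u + (r ⊕ s) or (p+q+1)·u + (r ⊗ s) according as r + s ≤ u or not, which g
-- preserves; so this is a well-defined group homomorphism.  It is positive with trivial
-- positive kernel, and on a chain such a homomorphism is an ℓ-group embedding.
module Submission where

open import Defs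
open import Level using (Level; _⊔_)
open import Data.Nat using (ℕ; zero; suc) renaming (_+_ to _+ℕ_)
open import Data.Integer using (+_; -[1+_])
open import Data.Product using (Σ; ∃₂; _×_; _,_; proj₁; proj₂)
open import Data.Sum using (_⊎_; inj₁; inj₂)
open import Algebra.Bundles using (AbelianGroup)
import Algebra.Properties.AbelianGroup as AbelianGroupProperties
import Algebra.Properties.CommutativeSemigroup as CommutativeSemigroupProperties
import Relation.Binary.Reasoning.Setoid as SetoidReasoning
open import Relation.Binary.Structures using (IsEquivalence)
open import Relation.Binary.PropositionalEquality using (refl)
open import Relation.Unary using (Pred)
open import Function.Bundles using (_⇔_; mk⇔)

module LGroupProperties {c ℓ : Level} (G : LGroup c ℓ) where
  open LGroup G public
  open LGroupOrder G public

  abelianGroup : AbelianGroup c ℓ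
  abelianGroup = record
    { Carrier = Carrier ; _≈_ = _≈_ ; _∙_ = _+_ ; ε = 0# ; _⁻¹ = -_
    ; isAbelianGroup = isAbelianGroup }

  open AbelianGroup abelianGroup public using (setoid; ∙-congˡ; ∙-congʳ)
  open AbelianGroupProperties abelianGroup public
    using (∙-cancelˡ; x≈z//y; x∙y⁻¹≈ε⇒x≈y; identityʳ-unique; ⁻¹-anti-homo‿-; ⁻¹-∙-comm;
           //-rightDividesˡ; //-rightDividesʳ; \\-leftDividesʳ)
  open CommutativeSemigroupProperties (AbelianGroup.commutativeSemigroup abelianGroup) public
    using (interchange)
  open SetoidReasoning setoid

  infixl 6 _-_
  _-_ : Carrier → Carrier → Carrier
  x - y = x + - y

  -‿interchange : ∀ x y z w → (x - y) + (z - w) ≈ (x + z) - (y + w)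
  -‿interchange x y z w = trans (interchange x (- y) z (- w)) (∙-congˡ (⁻¹-∙-comm y w))

  x+w≈z+y⇒x-y≈z-w : ∀ {x y z w} → x + w ≈ z + y → x - y ≈ z - w
  x+w≈z+y⇒x-y≈z-w {x} {y} {z} {w} e = begin
    x - y                   ≈⟨ identityʳ (x - y) ⟨
    (x - y) + 0#            ≈⟨ ∙-congˡ (inverseʳ w) ⟨
    (x - y) + (w - w)       ≈⟨ -‿interchange x y w w ⟩
    (x + w) - (y + w)       ≈⟨ ∙-cong e (⁻¹-cong (comm y w)) ⟩
    (z + y) - (w + y)       ≈⟨ -‿interchange z w y y ⟨
    (z - w) + (y - y)       ≈⟨ ∙-congˡ (inverseʳ y) ⟩
    (z - w) + 0#            ≈⟨ identityʳ (z - w) ⟩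
    z - w                   ∎

  x-y≈z-w⇒x+w≈z+y : ∀ {x y z w} → x - y ≈ z - w → x + w ≈ z + y
  x-y≈z-w⇒x+w≈z+y {x} {y} {z} {w} e = x∙y⁻¹≈ε⇒x≈y (x + w) (z + y) (begin
    (x + w) - (z + y)       ≈⟨ ∙-congˡ (⁻¹-cong (comm z y)) ⟩
    (x + w) - (y + z)       ≈⟨ -‿interchange x y w z ⟨
    (x - y) + (w - z)       ≈⟨ ∙-congʳ e ⟩
    (z - w) + (w - z)       ≈⟨ -‿interchange z w w z ⟩
    (z + w) - (w + z)       ≈⟨ ∙-congˡ (⁻¹-cong (comm w z)) ⟩
    (z + w) - (z + w)       ≈⟨ inverseʳ (z + w) ⟩
    0#                      ∎)

  ≤-antisym : ∀ {x y} → x ≤ y → y ≤ x → x ≈ y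
  ≤-antisym {x} {y} x≤y y≤x = trans (sym x≤y) (trans (∧-comm x y) y≤x)

  0≤y-x⇒x≤y : ∀ {x y} → 0# ≤ y - x → x ≤ y
  0≤y-x⇒x≤y {x} {y} p = ≤-respˡ (identityˡ x) (≤-respʳ (//-rightDividesˡ x y) (+-monoʳ x p))

  x-y≤0⇒x≤y : ∀ {x y} → x - y ≤ 0# → x ≤ y
  x-y≤0⇒x≤y {x} {y} p = ≤-respˡ (//-rightDividesˡ y x) (≤-respʳ (identityˡ y) (+-monoʳ y p))

  x≤z+y⇒x-y≤z : ∀ {x y z} → x ≤ z + y → x - y ≤ z
  x≤z+y⇒x-y≤z {x} {y} {z} p = ≤-respʳ (//-rightDividesʳ y z) (+-monoʳ (- y) p)

  x+y≤x⇒y≤0 : ∀ {x y} → x + y ≤ x → y ≤ 0#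
  x+y≤x⇒y≤0 {x} {y} p = ≤-respˡ (\\-leftDividesʳ x y) (≤-respʳ (inverseˡ x) (+-monoˡ (- x) p))

  x+y≈0⇒x≈0 : ∀ {x y} → 0# ≤ x → 0# ≤ y → x + y ≈ 0# → x ≈ 0#
  x+y≈0⇒x≈0 {x} {y} 0≤x 0≤y e =
    ≤-antisym (≤-respʳ e (≤-respˡ (identityʳ x) (+-monoˡ x 0≤y))) 0≤x

  x+y≈0⇒y≈0 : ∀ {x y} → 0# ≤ x → 0# ≤ y → x + y ≈ 0# → y ≈ 0#
  x+y≈0⇒y≈0 {x} {y} 0≤x 0≤y e = x+y≈0⇒x≈0 0≤y 0≤x (trans (comm y x) e)

  ∧≈ʳ⇒≤ : ∀ {x y} → x ∧ y ≈ y → y ≤ x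
  ∧≈ʳ⇒≤ {x} {y} e = trans (∧-comm y x) e

  0∨[x-y]≈0⇒x≤y : ∀ {x y} → 0# ∨ (x - y) ≈ 0# → x ≤ y
  0∨[x-y]≈0⇒x≤y e = x-y≤0⇒x≤y (≤-respʳ e (y≤x∨y _ _))

  x≤y⇒0∨[x-y]≈0 : ∀ {x y} → x ≤ y → 0# ∨ (x - y) ≈ 0#
  x≤y⇒0∨[x-y]≈0 {x} {y} p =
    trans (∨-comm 0# (x - y)) (≤⇒∨ (x≤z+y⇒x-y≤z (≤-respʳ (sym (identityˡ y)) p)))

  y≤x⇒0∨[x-y]≈x-y : ∀ {x y} → y ≤ x → 0# ∨ (x - y) ≈ x - y
  y≤x⇒0∨[x-y]≈x-y p = ≤⇒∨ (0≤-sub p)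

  0≤·ℕ : ∀ n {x} → 0# ≤ x → 0# ≤ n ·ℕ x
  0≤·ℕ zero    0≤x = ≤-refl
  0≤·ℕ (suc n) 0≤x = 0≤+ 0≤x (0≤·ℕ n 0≤x)

  ·ℕ-homo-+ : ∀ m n x → (m +ℕ n) ·ℕ x ≈ m ·ℕ x + n ·ℕ x
  ·ℕ-homo-+ zero    n x = sym (identityˡ (n ·ℕ x))
  ·ℕ-homo-+ (suc m) n x = trans (∙-congˡ (·ℕ-homo-+ m n x)) (sym (assoc x (m ·ℕ x) (n ·ℕ x)))

  ·ℕ-+-interchange : ∀ m n w a b → (m +ℕ n) ·ℕ w + (a + b) ≈ (m ·ℕ w + a) + (n ·ℕ w + b)
  ·ℕ-+-interchange m n w a b =
    trans (∙-congʳ (·ℕ-homo-+ m n w)) (interchange (m ·ℕ w) (n ·ℕ w) a b)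

  suc-·ℕ-carry : ∀ n w a → suc n ·ℕ w + (a - w) ≈ n ·ℕ w + a
  suc-·ℕ-carry n w a = begin
    (w + n ·ℕ w) + (a - w)  ≈⟨ ∙-congʳ (comm w (n ·ℕ w)) ⟩
    (n ·ℕ w + w) + (a - w)  ≈⟨ assoc (n ·ℕ w) w (a - w) ⟩
    n ·ℕ w + (w + (a - w))  ≈⟨ ∙-congˡ (trans (comm w (a - w)) (//-rightDividesˡ w a)) ⟩
    n ·ℕ w + a              ∎

module _ {ℓ i : Level} {I : Set i} (U : Ultrafilter I ℓ) where
  open Ultrafilter U

  everywhere : {P : I → Set ℓ} → (∀ j → P j) → P ∈U
  everywhere f = upward (λ j _ → f j) whole

  upward₂ : {P Q R : I → Set ℓ} → (∀ j → P j → Q j → R j) → P ∈U → Q ∈U → R ∈U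
  upward₂ f p q = upward (λ j (pj , qj) → f j pj qj) (meet p q)

  ultrapower : {c : Level} → LGroup c ℓ → LGroup (c ⊔ i) ℓ
  ultrapower B = record
    { Carrier = I → B.Carrier
    ; _≈_ = λ f g → (λ j → f j B.≈ g j) ∈U
    ; _+_ = λ f g j → f j B.+ g j
    ; 0# = λ _ → B.0#
    ; -_ = λ f j → B.- f j
    ; _∨_ = λ f g j → f j B.∨ g j
    ; _∧_ = λ f g j → f j B.∧ g j
    ; isAbelianGroup = record
      { isGroup = record
        { isMonoid = record
          { isSemigroup = record
            { isMagma = record { isEquivalence = isEquivalence ; ∙-cong = upward₂ (λ _ → B.∙-cong) }
            ; assoc = λ f g h → everywhere (λ j → B.assoc (f j) (g j) (h j)) }
          ; identity = (λ f → everywhere (λ j → B.identityˡ (f j)))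
                     , (λ f → everywhere (λ j → B.identityʳ (f j))) }
        ; inverse = (λ f → everywhere (λ j → B.inverseˡ (f j)))
                  , (λ f → everywhere (λ j → B.inverseʳ (f j)))
        ; ⁻¹-cong = upward (λ _ → B.⁻¹-cong) }
      ; comm = λ f g → everywhere (λ j → B.comm (f j) (g j)) }
    ; isLattice = record
      { isEquivalence = isEquivalence
      ; ∨-comm = λ f g → everywhere (λ j → B.∨-comm (f j) (g j))
      ; ∨-assoc = λ f g h → everywhere (λ j → B.∨-assoc (f j) (g j) (h j))
      ; ∨-cong = upward₂ (λ _ → B.∨-cong)
      ; ∧-comm = λ f g → everywhere (λ j → B.∧-comm (f j) (g j))
      ; ∧-assoc = λ f g h → everywhere (λ j → B.∧-assoc (f j) (g j) (h j))
      ; ∧-cong = upward₂ (λ _ → B.∧-cong)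
      ; absorptive = (λ f g → everywhere (λ j → B.∨-absorbs-∧ (f j) (g j)))
                   , (λ f g → everywhere (λ j → B.∧-absorbs-∨ (f j) (g j))) }
    ; +-distribʳ-∨ = λ f g h → everywhere (λ j → B.+-distribʳ-∨ (f j) (g j) (h j))
    ; +-distribʳ-∧ = λ f g h → everywhere (λ j → B.+-distribʳ-∧ (f j) (g j) (h j))
    }
    where
    module B = LGroup B
    isEquivalence : IsEquivalence (λ (f g : I → B.Carrier) → (λ j → f j B.≈ g j) ∈U)
    isEquivalence = record
      { refl = everywhere (λ _ → B.refl)
      ; sym = upward (λ _ → B.sym)
      ; trans = upward₂ (λ _ → B.trans) }

module LGroupMaps {a ℓa c ℓc : Level} (A : LGroup a ℓa) (C : LGroup c ℓc) where
  private
    module A = LGroupProperties A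
    module C = LGroupProperties C

  module DifferenceExtension {s : Level} {X : Set s} (ρ : X → A.Carrier) (F : X → C.Carrier)
    (F-resp : ∀ x y → ρ x A.≈ ρ y → F x C.≈ F y)
    (carry : ∀ x y → Σ X λ z → ρ z A.≈ ρ x A.+ ρ y × F z C.≈ F x C.+ F y)
    (difference : ∀ a → ∃₂ λ x y → a A.≈ ρ x A.- ρ y)
    where

    F-+-resp : ∀ {x y x' y'} → ρ x A.+ ρ y A.≈ ρ x' A.+ ρ y' → F x C.+ F y C.≈ F x' C.+ F y'
    F-+-resp {x} {y} {x'} {y'} e with carry x y | carry x' y'
    ... | z , ρz , Fz | z' , ρz' , Fz' =
      C.trans (C.sym Fz) (C.trans (F-resp z z' (A.trans ρz (A.trans e (A.sym ρz')))) Fz')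

    extension : A.Carrier → C.Carrier
    extension a = F (proj₁ d) C.- F (proj₁ (proj₂ d))
      where d = difference a

    extension-spec : ∀ {a} x y → a A.≈ ρ x A.- ρ y → extension a C.≈ F x C.- F y
    extension-spec {a} x y e = C.x+w≈z+y⇒x-y≈z-w (F-+-resp (A.x-y≈z-w⇒x+w≈z+y
      (A.trans (A.sym (proj₂ (proj₂ (difference a)))) e)))

    extension-cong : ∀ {a b} → a A.≈ b → extension a C.≈ extension b
    extension-cong {a} {b} e with difference b
    ... | x , y , b≈ = extension-spec x y (A.trans e b≈)

    extension-ρ : ∀ x → extension (ρ x) C.≈ F x
    extension-ρ x with carry x x
    ... | z , ρz , Fz = C.trans (extension-spec z x (A.x≈z//y (ρ x) (ρ x) (ρ z) (A.sym ρz)))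
                         (C.trans (C.∙-congʳ Fz) (C.//-rightDividesʳ (F x) (F x)))

    extension-+ : ∀ a b → extension (a A.+ b) C.≈ extension a C.+ extension b
    extension-+ a b with difference a | difference b
    ... | x , y , a≈ | x' , y' , b≈ with carry x x' | carry y y'
    ... | z , ρz , Fz | w , ρw , Fw = begin
      extension (a A.+ b)                   ≈⟨ extension-spec z w a+b≈ ⟩
      F z C.- F w                           ≈⟨ C.∙-cong Fz (C.⁻¹-cong Fw) ⟩
      (F x C.+ F x') C.- (F y C.+ F y')     ≈⟨ C.-‿interchange (F x) (F y) (F x') (F y') ⟨
      (F x C.- F y) C.+ (F x' C.- F y')     ∎
      where
      open SetoidReasoning C.setoid
      a+b≈ : a A.+ b A.≈ ρ z A.- ρ w
      a+b≈ = A.trans (A.∙-cong a≈ b≈) (A.trans (A.-‿interchange (ρ x) (ρ y) (ρ x') (ρ y'))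
               (A.sym (A.∙-cong ρz (A.⁻¹-cong ρw))))

    extension-neg : ∀ a → extension (A.- a) C.≈ C.- extension a
    extension-neg a with difference a
    ... | x , y , a≈ = C.trans
      (extension-spec y x (A.trans (A.⁻¹-cong a≈) (A.⁻¹-anti-homo‿- (ρ x) (ρ y))))
      (C.sym (C.⁻¹-anti-homo‿- (F x) (F y)))

    extension-0 : extension A.0# C.≈ C.0#
    extension-0 = C.identityʳ-unique (extension A.0#) (extension A.0#)
      (C.trans (C.sym (extension-+ A.0# A.0#)) (extension-cong (A.identityʳ A.0#)))

  module ChainEmbedding (total : ∀ a b → a A.≤ b ⊎ b A.≤ a) (G : A.Carrier → C.Carrier)
    (G-cong : ∀ {a b} → a A.≈ b → G a C.≈ G b)
    (G-+ : ∀ a b → G (a A.+ b) C.≈ G a C.+ G b)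
    (G-neg : ∀ a → G (A.- a) C.≈ C.- G a)
    (G-nonneg : ∀ {d} → A.0# A.≤ d → C.0# C.≤ G d)
    (G-kernel : ∀ {d} → A.0# A.≤ d → G d C.≈ C.0# → d A.≈ A.0#)
    where

    G-difference : ∀ a b → G (b A.- a) C.≈ G b C.- G a
    G-difference a b = C.trans (G-+ b (A.- a)) (C.∙-congˡ (G-neg a))

    G-mono : ∀ {a b} → a A.≤ b → G a C.≤ G b
    G-mono {a} {b} a≤b = C.0≤y-x⇒x≤y (C.≤-respʳ (G-difference a b) (G-nonneg (A.0≤-sub a≤b)))

    G-∧ : ∀ a b → G (a A.∧ b) C.≈ G a C.∧ G b
    G-∧ a b with total a b
    ... | inj₁ a≤b = C.trans (G-cong a≤b) (C.sym (G-mono a≤b))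
    ... | inj₂ b≤a = C.trans (G-cong (A.trans (A.∧-comm a b) b≤a))
                       (C.trans (C.sym (G-mono b≤a)) (C.∧-comm (G b) (G a)))

    G-∨ : ∀ a b → G (a A.∨ b) C.≈ G a C.∨ G b
    G-∨ a b with total a b
    ... | inj₁ a≤b = C.trans (G-cong (A.≤⇒∨ a≤b)) (C.sym (C.≤⇒∨ (G-mono a≤b)))
    ... | inj₂ b≤a = C.trans (G-cong (A.trans (A.∨-comm a b) (A.≤⇒∨ b≤a)))
                       (C.trans (C.sym (C.≤⇒∨ (G-mono b≤a))) (C.∨-comm (G b) (G a)))

    G-injective-≤ : ∀ {a b} → a A.≤ b → G a C.≈ G b → a A.≈ b
    G-injective-≤ {a} {b} a≤b e = A.sym (A.x∙y⁻¹≈ε⇒x≈y b a (G-kernel (A.0≤-sub a≤b)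
      (C.trans (G-difference a b) (C.trans (C.∙-congʳ (C.sym e)) (C.inverseʳ (G a))))))

    G-injective : ∀ {a b} → G a C.≈ G b → a A.≈ b
    G-injective {a} {b} e with total a b
    ... | inj₁ a≤b = G-injective-≤ a≤b e
    ... | inj₂ b≤a = A.sym (G-injective-≤ b≤a (C.sym e))

-- An MV-embedding Γ(A_u) → Γ(C_v) viewed as a map into C.
record IntervalEmbedding {a ℓa c ℓc : Level} (A : PointedLGroup a ℓa)
  (0≤u : PointedLGroup._≤_ A (PointedLGroup.0# A) (PointedLGroup.u A))
  (C : LGroup c ℓc) (v : LGroup.Carrier C) : Set (a ⊔ ℓa ⊔ c ⊔ ℓc) where
  private
    module ΓA = MVStr (Γ A 0≤u)
    module C = LGroupProperties C
  field
    h : ΓA.Carrier → C.Carrier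
    h-cong : ∀ {x y} → x ΓA.≈ y → h x C.≈ h y
    h-inj : ∀ {x y} → h x C.≈ h y → x ΓA.≈ y
    h-⊕ : ∀ x y → h (x ΓA.⊕ y) C.≈ (h x C.+ h y) C.∧ v
    h-⊗ : ∀ x y → h (x ΓA.⊗ y) C.≈ C.0# C.∨ (h x C.+ h y C.- v)
    h-0 : h ΓA.0# C.≈ C.0#
    h-1 : h ΓA.1# C.≈ v
    h-nonneg : ∀ x → C.0# C.≤ h x

module IntervalExtension {a ℓa c ℓc : Level} (A : PointedLGroup a ℓa) (totA : TotallyOrdered A)
  (spA : StronglyPositivelyPointed A) (C : LGroup c ℓc) {v : LGroup.Carrier C}
  (emb : IntervalEmbedding A (proj₁ spA) C v) where
  private
    module A = LGroupProperties (PointedLGroup.lgroup A)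
    module C = LGroupProperties C
    module ΓA = MVStr (Γ A (proj₁ spA))
  open IntervalEmbedding emb
  open A using (_≈_; _+_; -_; _-_; _≤_; 0#; _·ℕ_)
  open PointedLGroup A using (lgroup; u)

  0≤u : 0# ≤ u
  0≤u = proj₁ spA

  0≤v : C.0# C.≤ v
  0≤v = C.≤-respʳ h-1 (h-nonneg ΓA.1#)

  ⌊_⌋ : ΓA.Carrier → A.Carrier
  ⌊_⌋ = proj₁

  h-+-below : ∀ {r s} → ⌊ r ⌋ + ⌊ s ⌋ ≤ u → h (r ΓA.⊕ s) C.≈ h r C.+ h s
  h-+-below {r} {s} r+s≤u = C.trans (h-⊕ r s) hr+hs≤v
    where
    hr+hs≤v : h r C.+ h s C.≤ v
    hr+hs≤v = C.0∨[x-y]≈0⇒x≤y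
      (C.trans (C.sym (h-⊗ r s)) (C.trans (h-cong (A.x≤y⇒0∨[x-y]≈0 r+s≤u)) h-0))

  h-+-above : ∀ {r s} → u ≤ ⌊ r ⌋ + ⌊ s ⌋ → h (r ΓA.⊗ s) C.≈ h r C.+ h s C.- v
  h-+-above {r} {s} u≤r+s = C.trans (h-⊗ r s) (C.y≤x⇒0∨[x-y]≈x-y v≤hr+hs)
    where
    v≤hr+hs : v C.≤ h r C.+ h s
    v≤hr+hs = C.∧≈ʳ⇒≤
      (C.trans (C.sym (h-⊕ r s)) (C.trans (h-cong (A.trans (A.∧-comm _ _) u≤r+s)) h-1))

  Digits : Set (a ⊔ ℓa)
  Digits = ℕ × ΓA.Carrier

  valueA : Digits → A.Carrier
  valueA (p , r) = p ·ℕ u + ⌊ r ⌋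

  valueC : Digits → C.Carrier
  valueC (p , r) = p C.·ℕ v C.+ h r

  valueC-resp-digit : ∀ k r s → valueA (k , r) ≈ ⌊ s ⌋ → valueC (k , r) C.≈ h s
  valueC-resp-digit zero r s e =
    C.trans (C.identityˡ (h r)) (h-cong (A.trans (A.sym (A.identityˡ ⌊ r ⌋)) e))
  valueC-resp-digit (suc k) r s e = begin
    (v C.+ k C.·ℕ v) C.+ h r  ≈⟨ C.assoc v (k C.·ℕ v) (h r) ⟩
    v C.+ (k C.·ℕ v C.+ h r)  ≈⟨ C.∙-congˡ (C.trans (valueC-resp-digit k r ΓA.0# t≈0) h-0) ⟩
    v C.+ C.0#                ≈⟨ C.identityʳ v ⟩
    v                         ≈⟨ h-1 ⟨
    h ΓA.1#                   ≈⟨ h-cong (A.sym s≈u) ⟩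
    h s                       ∎
    where
    open SetoidReasoning C.setoid
    t : A.Carrier
    t = k ·ℕ u + ⌊ r ⌋
    u+t≈s : u + t ≈ ⌊ s ⌋
    u+t≈s = A.trans (A.sym (A.assoc u (k ·ℕ u) ⌊ r ⌋)) e
    t≈0 : t ≈ 0#
    t≈0 = A.≤-antisym (A.x+y≤x⇒y≤0 (A.≤-respˡ (A.sym u+t≈s) (proj₂ (proj₂ s))))
                      (A.0≤+ (A.0≤·ℕ k 0≤u) (proj₁ (proj₂ r)))
    s≈u : ⌊ s ⌋ ≈ u
    s≈u = A.trans (A.sym u+t≈s) (A.trans (A.∙-congˡ t≈0) (A.identityʳ u))

  -- Two representations of one element differ only by carries (p+1)·u + 0 = p·u + u.
  valueC-resp : ∀ x y → valueA x ≈ valueA y → valueC x C.≈ valueC y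
  valueC-resp (zero , r) (q , s) e = C.trans (C.identityˡ (h r))
    (C.sym (valueC-resp-digit q s r (A.trans (A.sym e) (A.identityˡ ⌊ r ⌋))))
  valueC-resp (suc p , r) (zero , s) e = C.trans
    (valueC-resp-digit (suc p) r s (A.trans e (A.identityˡ ⌊ s ⌋))) (C.sym (C.identityˡ (h s)))
  valueC-resp (suc p , r) (suc q , s) e =
    C.trans (C.assoc v _ _) (C.trans (C.∙-congˡ (valueC-resp (p , r) (q , s) cancelled))
      (C.sym (C.assoc v _ _)))
    where
    cancelled : valueA (p , r) ≈ valueA (q , s)
    cancelled = A.∙-cancelˡ u _ _
      (A.trans (A.sym (A.assoc u _ _)) (A.trans e (A.assoc u _ _)))

  carry : ∀ x y → Σ Digits λ z →
            valueA z ≈ valueA x + valueA y × valueC z C.≈ valueC x C.+ valueC y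
  carry (p , r) (q , s) with totA (⌊ r ⌋ + ⌊ s ⌋) u
  ... | inj₁ r+s≤u = (p +ℕ q , r ΓA.⊕ s)
    , A.trans (A.∙-congˡ r+s≤u) (A.·ℕ-+-interchange p q u ⌊ r ⌋ ⌊ s ⌋)
    , C.trans (C.∙-congˡ (h-+-below r+s≤u)) (C.·ℕ-+-interchange p q v (h r) (h s))
  ... | inj₂ u≤r+s = (suc (p +ℕ q) , r ΓA.⊗ s)
    , A.trans (A.∙-congˡ (A.y≤x⇒0∨[x-y]≈x-y u≤r+s))
        (A.trans (A.suc-·ℕ-carry (p +ℕ q) u _) (A.·ℕ-+-interchange p q u ⌊ r ⌋ ⌊ s ⌋))
    , C.trans (C.∙-congˡ (h-+-above u≤r+s))
        (C.trans (C.suc-·ℕ-carry (p +ℕ q) v _) (C.·ℕ-+-interchange p q v (h r) (h s)))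

  bound : ∀ d → Σ ℕ λ n → d ≤ n ·ℕ u
  bound d with proj₂ spA d
  ... | + n , d≤nu = n , d≤nu
  ... | -[1+ n ] , d≤-nu = 0 , A.≤-trans d≤-nu (A.≤0-neg (A.0≤·ℕ (suc n) 0≤u))

  floor : ∀ n {b} → 0# ≤ b → b ≤ n ·ℕ u → Σ ℕ λ p → p ·ℕ u ≤ b × b ≤ suc p ·ℕ u
  floor zero    0≤b b≤0 = 0 , 0≤b , A.≤-trans b≤0 (A.0≤+ 0≤u A.≤-refl)
  floor (suc n) {b} 0≤b b≤ with totA b (n ·ℕ u)
  ... | inj₁ b≤nu = floor n 0≤b b≤nu
  ... | inj₂ nu≤b = n , nu≤b , b≤

  nonneg-digits : ∀ {b} → 0# ≤ b → Σ Digits λ x → b ≈ valueA x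
  nonneg-digits {b} 0≤b with floor (proj₁ (bound b)) 0≤b (proj₂ (bound b))
  ... | p , pu≤b , b≤ =
    (p , (b - p ·ℕ u , A.0≤-sub pu≤b , A.x≤z+y⇒x-y≤z b≤))
    , A.sym (A.trans (A.comm (p ·ℕ u) _) (A.//-rightDividesˡ (p ·ℕ u) b))

  difference : ∀ a → ∃₂ λ x y → a ≈ valueA x - valueA y
  difference a with bound (- a)
  ... | q , -a≤qu with nonneg-digits (A.≤-respˡ (A.inverseʳ a) (A.+-monoˡ a -a≤qu))
  ... | x , a+qu≈ = x , (q , ΓA.0#)
    , A.x≈z//y a (valueA (q , ΓA.0#)) (valueA x) (A.trans (A.∙-congˡ (A.identityʳ (q ·ℕ u))) a+qu≈)

  valueC-nonneg : ∀ x → C.0# C.≤ valueC x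
  valueC-nonneg (p , r) = C.0≤+ (C.0≤·ℕ p 0≤v) (h-nonneg r)

  valueC-kernel : ∀ x → valueC x C.≈ C.0# → valueA x ≈ 0#
  valueC-kernel (zero , r) e = A.trans (A.identityˡ ⌊ r ⌋)
    (h-inj (C.trans (C.sym (C.identityˡ (h r))) (C.trans e (C.sym h-0))))
  valueC-kernel (suc p , r) e = A.trans (A.assoc u (p ·ℕ u) ⌊ r ⌋)
    (A.trans (A.∙-cong u≈0 (valueC-kernel (p , r) rest≈0)) (A.identityʳ 0#))
    where
    v+rest≈0 : v C.+ valueC (p , r) C.≈ C.0#
    v+rest≈0 = C.trans (C.sym (C.assoc v (p C.·ℕ v) (h r))) e
    v≈0 : v C.≈ C.0#
    v≈0 = C.x+y≈0⇒x≈0 0≤v (valueC-nonneg (p , r)) v+rest≈0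
    rest≈0 : valueC (p , r) C.≈ C.0#
    rest≈0 = C.x+y≈0⇒y≈0 0≤v (valueC-nonneg (p , r)) v+rest≈0
    u≈0 : u ≈ 0#
    u≈0 = h-inj (C.trans h-1 (C.trans v≈0 (C.sym h-0)))

  open LGroupMaps.DifferenceExtension lgroup C valueA valueC valueC-resp carry difference public
    using (extension; extension-cong; extension-ρ; extension-+; extension-neg; extension-0)

  extension-nonneg : ∀ {d} → 0# ≤ d → C.0# C.≤ extension d
  extension-nonneg 0≤d with nonneg-digits 0≤d
  ... | x , d≈ = C.≤-respʳ (C.sym (C.trans (extension-cong d≈) (extension-ρ x))) (valueC-nonneg x)

  extension-kernel : ∀ {d} → 0# ≤ d → extension d C.≈ C.0# → d ≈ 0#
  extension-kernel 0≤d e with nonneg-digits 0≤d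
  ... | x , d≈ = A.trans d≈ (valueC-kernel x
                  (C.trans (C.sym (extension-ρ x)) (C.trans (extension-cong (A.sym d≈)) e)))

  extension-u : extension u C.≈ v
  extension-u = C.trans (extension-cong (A.sym (A.identityˡ u)))
    (C.trans (extension-ρ (0 , ΓA.1#)) (C.trans (C.identityˡ (h ΓA.1#)) h-1))

  open LGroupMaps.ChainEmbedding lgroup C totA extension extension-cong extension-+ extension-neg
    extension-nonneg extension-kernel public
    using () renaming (G-∧ to extension-∧; G-∨ to extension-∨; G-injective to extension-injective)

module Restriction {c ℓ i : Level} (A B : PointedLGroup c ℓ) {I : Set i} (U : Ultrafilter I ℓ)
  (0≤u : PointedLGroup._≤_ A (PointedLGroup.0# A) (PointedLGroup.u A))
  (0≤v : PointedLGroup._≤_ B (PointedLGroup.0# B) (PointedLGroup.u B))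
  (emb : LEmbedding A B U) where
  private
    module A = PointedLGroup A
    module B = LGroupProperties (PointedLGroup.lgroup B)
    module C = LGroupProperties (ultrapower U (PointedLGroup.lgroup B))
    module ΓA = MVStr (Γ A 0≤u)
    module ΓB = MVStr (Γ B 0≤v)
    module E = LEmbedding emb
  open PointedLGroup B using (u)

  v : C.Carrier
  v _ = u

  -- E.h a lies in [0, v] only on a U-large set of coordinates.
  clip : B.Carrier → ΓB.Carrier
  clip b = (B.0# B.∨ b) B.∧ u , B.∧-greatest (B.x≤x∨y B.0# b) 0≤v , B.x∧y≤y _ _

  h : ΓA.Carrier → I → ΓB.Carrier
  h x j = clip (E.h (proj₁ x) j)

  ⌊h⌋ : ΓA.Carrier → C.Carrier
  ⌊h⌋ x j = proj₁ (h x j)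

  E-mono : ∀ {a b} → a A.≤ b → E.h a C.≤ E.h b
  E-mono {a} {b} a≤b = C.trans (C.sym (E.h-∧ a b)) (E.h-cong a≤b)

  clip-invisible : ∀ x → ⌊h⌋ x C.≈ E.h (proj₁ x)
  clip-invisible (a , 0≤a , a≤u) = C.trans (C.∧-cong (C.≤⇒∨ 0≤ha) C.refl) ha≤v
    where
    0≤ha : C.0# C.≤ E.h a
    0≤ha = C.≤-respˡ E.h-0 (E-mono 0≤a)
    ha≤v : E.h a C.≤ v
    ha≤v = C.≤-respʳ E.h-u (E-mono a≤u)

  restriction : MVEmbedding (Γ A 0≤u) (Γ B 0≤v) U
  restriction = record
    { h = h
    ; h-cong = λ {x} {y} x≈y → C.trans (clip-invisible x) (C.trans (E.h-cong x≈y) (back y))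
    ; h-inj = λ {x} {y} hx≈hy → E.h-inj (C.trans (back x) (C.trans hx≈hy (clip-invisible y)))
    ; h-⊕ = λ x y → via (x ΓA.⊕ y) (C.trans (E.h-∧ _ _)
                      (C.∧-cong (C.trans (E.h-+ _ _) (C.∙-cong (back x) (back y))) E.h-u))
    ; h-⊗ = λ x y → via (x ΓA.⊗ y) (C.trans (E.h-∨ _ _) (C.∨-cong E.h-0
                      (C.trans (E.h-+ _ _) (C.∙-cong (C.trans (E.h-+ _ _) (C.∙-cong (back x) (back y)))
                        (C.trans (E.h-neg _) (C.⁻¹-cong E.h-u))))))
    ; h-∨ = λ x y → via (x ΓA.∨ y) (C.trans (E.h-∨ _ _) (C.∨-cong (back x) (back y)))
    ; h-∧ = λ x y → via (x ΓA.∧ y) (C.trans (E.h-∧ _ _) (C.∧-cong (back x) (back y)))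
    ; h-¬ = λ x → via (ΓA.¬ x) (C.trans (E.h-+ _ _) (C.∙-cong E.h-u (C.trans (E.h-neg _) (C.⁻¹-cong (back x)))))
    ; h-0 = via ΓA.0# E.h-0
    ; h-1 = via ΓA.1# E.h-u
    }
    where
    back : ∀ x → E.h (proj₁ x) C.≈ ⌊h⌋ x
    back x = C.sym (clip-invisible x)
    via : ∀ x {f} → E.h (proj₁ x) C.≈ f → ⌊h⌋ x C.≈ f
    via x = C.trans (clip-invisible x)

module _ {c ℓ i : Level} {A B : PointedLGroup c ℓ} {I : Set i} {U : Ultrafilter I ℓ}
  {0≤v : PointedLGroup._≤_ B (PointedLGroup.0# B) (PointedLGroup.u B)} where
  private
    Bᴵ/U = ultrapower U (PointedLGroup.lgroup B)
    v : LGroup.Carrier Bᴵ/U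
    v _ = PointedLGroup.u B

  toIntervalEmbedding : ∀ {0≤u} → MVEmbedding (Γ A 0≤u) (Γ B 0≤v) U → IntervalEmbedding A 0≤u Bᴵ/U v
  toIntervalEmbedding emb = record
    { h = λ x j → proj₁ (E.h x j)
    ; h-cong = E.h-cong
    ; h-inj = E.h-inj
    ; h-⊕ = E.h-⊕
    ; h-⊗ = E.h-⊗
    ; h-0 = E.h-0
    ; h-1 = E.h-1
    ; h-nonneg = λ x → everywhere U (λ j → proj₁ (proj₂ (E.h x j)))
    }
    where module E = MVEmbedding emb

  extendFromΓ : TotallyOrdered A → (spA : StronglyPositivelyPointed A)
              → MVEmbedding (Γ A (proj₁ spA)) (Γ B 0≤v) U → LEmbedding A B U
  extendFromΓ totA spA emb = record
    { h = extension
    ; h-cong = extension-cong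
    ; h-inj = extension-injective
    ; h-+ = extension-+
    ; h-0 = extension-0
    ; h-neg = extension-neg
    ; h-∨ = extension-∨
    ; h-∧ = extension-∧
    ; h-u = extension-u
    }
    where open IntervalExtension A totA spA Bᴵ/U (toIntervalEmbedding emb)

lemma6p5 : {c ℓ k : Level} (i : Level) (K : Pred (PointedLGroup c ℓ) k) (A : PointedLGroup c ℓ)
    → (∀ B → K B → TotallyOrdered B × StronglyPositivelyPointed B)
    → TotallyOrdered A
    → (spA : StronglyPositivelyPointed A)
    → ISPU-ℓ i K A ⇔ ISPU-MV i Γ[ K ] (Γ A (proj₁ spA))
lemma6p5 i K A K-spp totA spA = mk⇔ restrict extend
  where
  restrict : ISPU-ℓ i K A → ISPU-MV i Γ[ K ] (Γ A (proj₁ spA))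
  restrict (B , KB , I , U , emb) =
    Γ B 0≤v , (B , KB , 0≤v , refl) , I , U , Restriction.restriction A B U (proj₁ spA) 0≤v emb
    where 0≤v = proj₁ (proj₂ (K-spp B KB))
  extend : ISPU-MV i Γ[ K ] (Γ A (proj₁ spA)) → ISPU-ℓ i K A
  extend (_ , (B , KB , 0≤v , refl) , I , U , emb) = B , KB , I , U , extendFromΓ totA spA emb
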